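{- For all formulas $A_1,X_1,\dots,A_n,X_n,B,Y$: the I/O sequent $(A_1,X_1),\dots,(A_n,X_n)\vdash(B,Y)$ is derivable in $\mathbf{C}_1$ iff for every partition $(I,J)\in\mathcal{P}(\{1,\dots,n\})$ at least one of the following holds: (i) $B\Rightarrow A_i$ is derivable in LK for some $i\in I$; (ii) $B\Rightarrow$ is derivable in LK; (iii) $\{X_j\}_{j\in J}\Rightarrow Y$ is derivable in LK.
   Context: Formulas are classical propositional formulas; $\models$ is classical entailment. An LK sequent $\Gamma\Rightarrow\Delta$ is derivable in LK iff $\bigwedge\Gamma\models\bigvee\Delta$ (empty conjunction $=\top$, empty disjunction $=\bot$). An I/O pair is an ordered pair $(A,X)$ of formulas; an I/O sequent has the form $G\vdash(B,Y)$ with $G$ a finite multiset of pairs. The calculus $\mathbf{C}_1$ has the rules: (IN) from $B\Rightarrow$ infer $G\vdash(B,Y)$; (OUT) from $\Rightarrow Y$ infer $G\vdash(B,Y)$; (E1) from the LK sequent $B\Rightarrow A$ and $G\vdash(B,Y\vee\neg X)$ infer $(A,X),G\vdash(B,Y)$. An I/O sequent is derivable in $\mathbf{C}_1$ if it is the root of a finite tree built with these rules in which every LK-sequent premise is derivable in LK. $\mathcal{P}(S)$ denotes the set of pairs $(I,J)$ with $I\cup J=S$ and $I\cap J=\emptyset$. -}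

module Defs where

open import Data.Nat using (ℕ)
open import Data.Bool using (Bool; true; false; _∧_; _∨_; not)
open import Data.List using (List; []; _∷_; _++_)
open import Data.Product using (_×_; _,_)
open import Data.Vec using (Vec; []; _∷_)
open import Data.Fin using (Fin; zero; suc)
open import Data.Fin.Subset using (Subset)
open import Relation.Binary.PropositionalEquality using (_≡_)

data Formula : Set where
  atom : ℕ → Formula
  ⊤f ⊥f : Formula
  ¬f_ : Formula → Formula
  _∧f_ _∨f_ _⇒f_ : Formula → Formula → Formula

infixr 6 _∧f_
infixr 5 _∨f_
infixr 4 _⇒f_

Valuation : Set
Valuation = ℕ → Bool

⟦_⟧ : Formula → Valuation → Bool
⟦ atom p ⟧ v = v p
⟦ ⊤f ⟧ v = true
⟦ ⊥f ⟧ v = false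
⟦ ¬f A ⟧ v = not (⟦ A ⟧ v)
⟦ A ∧f B ⟧ v = ⟦ A ⟧ v ∧ ⟦ B ⟧ v
⟦ A ∨f B ⟧ v = ⟦ A ⟧ v ∨ ⟦ B ⟧ v
⟦ A ⇒f B ⟧ v = not (⟦ A ⟧ v) ∨ ⟦ B ⟧ v

⋀ : List Formula → Formula
⋀ [] = ⊤f
⋀ (A ∷ Γ) = A ∧f ⋀ Γ

⋁ : List Formula → Formula
⋁ [] = ⊥f
⋁ (A ∷ Δ) = A ∨f ⋁ Δ

_⊨_ : Formula → Formula → Set
A ⊨ B = (v : Valuation) → ⟦ A ⟧ v ≡ true → ⟦ B ⟧ v ≡ true

-- LK-derivability of Γ ⇒ Δ, via the stated characterisation ⋀Γ ⊨ ⋁Δ.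
LK⊢ : List Formula → List Formula → Set
LK⊢ Γ Δ = ⋀ Γ ⊨ ⋁ Δ

IOPair : Set
IOPair = Formula × Formula

-- Derivability in C₁.  E1 may act on any element of the multiset G:
-- the context G₁ ++ (A , X) ∷ G₂ has the remaining multiset G₁ ++ G₂.
data C₁⊢ : List IOPair → IOPair → Set where
  IN  : ∀ {G B Y} → LK⊢ (B ∷ []) [] → C₁⊢ G (B , Y)
  OUT : ∀ {G B Y} → LK⊢ [] (Y ∷ []) → C₁⊢ G (B , Y)
  E1  : ∀ {G₁ G₂ A X B Y} →
        LK⊢ (B ∷ []) (A ∷ []) →
        C₁⊢ (G₁ ++ G₂) (B , Y ∨f ¬f X) →
        C₁⊢ (G₁ ++ (A , X) ∷ G₂) (B , Y)

pairsList : ∀ {n} → Vec IOPair n → List IOPair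
pairsList [] = []
pairsList (p ∷ ps) = p ∷ pairsList ps

outsOutside : ∀ {n} → Subset n → Vec IOPair n → List Formula
outsOutside [] [] = []
outsOutside (true ∷ I) (_ ∷ ps) = outsOutside I ps
outsOutside (false ∷ I) ((_ , X) ∷ ps) = X ∷ outsOutside I ps

-- Reading E1 backwards, a derivation of (A₁,X₁),…,(Aₙ,Xₙ) ⊢ (B,Y) decides for each
-- pair, in turn, whether to eliminate it (which needs B ⊨ Aᵢ and adds ¬Xᵢ to the output)
-- or to leave it in the context, where IN and OUT ignore it.  Since eliminations commute,
-- derivability is captured by a condition unfolded along the list, one pair at a time;
-- unfolding that condition over all n pairs yields exactly the 2ⁿ partition clauses,
-- the clause for (I , J) collecting ¬Xⱼ (j ∈ J) into Y, i.e. {Xⱼ}ⱼ∈J ⇒ Y.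
module Submission where

open import Defs
open import Data.Nat using (ℕ; zero; suc)
open import Data.Bool using (true; false; _∧_; _∨_; not)
open import Data.Bool.Properties using (∨-identityʳ; ∨-zeroʳ; ∨-commutativeMonoid)
open import Data.List using (List; []; _∷_; _++_)
open import Data.Product using (_×_; _,_; ∃-syntax; proj₁)
open import Data.Sum using (_⊎_; inj₁; inj₂; map₂)
open import Data.Vec using (Vec; lookup; []; _∷_; here; there)
open import Data.Fin using (zero; suc)
open import Data.Fin.Subset using (Subset; _∈_)
open import Function.Bundles using (_⇔_; mk⇔; Equivalence)
import Function.Properties.Equivalence as ⇔
open import Relation.Binary.PropositionalEquality using (_≡_; refl; sym; trans)
open import Algebra.Bundles using (CommutativeMonoid)
open import Algebra.Properties.CommutativeSemigroup
  (CommutativeMonoid.commutativeSemigroup ∨-commutativeMonoid) using (xy∙z≈xz∙y)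

open Equivalence using (to; from)

∨-monoˡ-true : ∀ {x y} z → (x ≡ true → y ≡ true) → x ∨ z ≡ true → y ∨ z ≡ true
∨-monoˡ-true {true} _ x⇒y _ rewrite x⇒y refl = refl
∨-monoˡ-true {false} {y} z _ z≡true rewrite z≡true = ∨-zeroʳ y

∧-curry-true : ∀ x {g y} → (x ∧ g ≡ true → y ≡ true) → g ≡ true → y ∨ not x ≡ true
∧-curry-true true {y = y} h g≡true = trans (∨-identityʳ y) (h g≡true)
∧-curry-true false {y = y} _ _ = ∨-zeroʳ y

∧-uncurry-true : ∀ x {g y} → (g ≡ true → y ∨ not x ≡ true) → x ∧ g ≡ true → y ≡ true
∧-uncurry-true true {y = y} h g≡true = trans (sym (∨-identityʳ y)) (h g≡true)

Y⊨Y∨Z : ∀ Y Z → Y ⊨ (Y ∨f Z)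
Y⊨Y∨Z _ _ v ⟦Y⟧ rewrite ⟦Y⟧ = refl

∨-monoˡ-⊨ : ∀ Y Y′ Z → Y ⊨ Y′ → (Y ∨f Z) ⊨ (Y′ ∨f Z)
∨-monoˡ-⊨ _ _ Z Y⊨Y′ v = ∨-monoˡ-true (⟦ Z ⟧ v) (Y⊨Y′ v)

∨-swapʳ-⊨ : ∀ Y Z W → ((Y ∨f Z) ∨f W) ⊨ ((Y ∨f W) ∨f Z)
∨-swapʳ-⊨ Y Z W v = trans (xy∙z≈xz∙y (⟦ Y ⟧ v) (⟦ W ⟧ v) (⟦ Z ⟧ v))

LK-succedent-mono : ∀ Γ Y Y′ → Y ⊨ Y′ → LK⊢ Γ (Y ∷ []) → LK⊢ Γ (Y′ ∷ [])
LK-succedent-mono _ _ _ Y⊨Y′ d v ⟦Γ⟧ = ∨-monoˡ-true false (Y⊨Y′ v) (d v ⟦Γ⟧)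

LK-deduction : ∀ X Γ Y → LK⊢ (X ∷ Γ) (Y ∷ []) ⇔ LK⊢ Γ ((Y ∨f ¬f X) ∷ [])
LK-deduction X Γ Y = mk⇔
  (λ d v ⟦Γ⟧ → padʳ (∧-curry-true (⟦ X ⟧ v) (λ ⟦XΓ⟧ → unpadʳ (d v ⟦XΓ⟧)) ⟦Γ⟧))
  (λ d v ⟦XΓ⟧ → padʳ (∧-uncurry-true (⟦ X ⟧ v) (λ ⟦Γ⟧ → unpadʳ (d v ⟦Γ⟧)) ⟦XΓ⟧))
  where
  padʳ : ∀ {x} → x ≡ true → x ∨ false ≡ true
  padʳ = trans (∨-identityʳ _)
  unpadʳ : ∀ {x} → x ∨ false ≡ true → x ≡ true
  unpadʳ = trans (sym (∨-identityʳ _))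

-- The partition condition unfolded along the context: the head pair either goes into I
-- (left factor) or into J (right factor, where ¬X is absorbed into the output).
Criterion : List IOPair → Formula → Formula → Set
Criterion [] B Y = LK⊢ (B ∷ []) [] ⊎ LK⊢ [] (Y ∷ [])
Criterion ((A , X) ∷ G) B Y =
  (LK⊢ (B ∷ []) (A ∷ []) ⊎ Criterion G B Y) × Criterion G B (Y ∨f ¬f X)

criterion-mono : ∀ G B Y Y′ → Y ⊨ Y′ → Criterion G B Y → Criterion G B Y′
criterion-mono [] _ Y Y′ Y⊨Y′ = map₂ (LK-succedent-mono [] Y Y′ Y⊨Y′)
criterion-mono ((_ , X) ∷ G) B Y Y′ Y⊨Y′ (inI , inJ) =
  map₂ (criterion-mono G B Y Y′ Y⊨Y′) inI ,
  criterion-mono G B (Y ∨f ¬f X) (Y′ ∨f ¬f X) (∨-monoˡ-⊨ Y Y′ (¬f X) Y⊨Y′) inJ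

criterion-IN : ∀ G B Y → LK⊢ (B ∷ []) [] → Criterion G B Y
criterion-IN [] _ _ B⊨⊥ = inj₁ B⊨⊥
criterion-IN ((_ , X) ∷ G) B Y B⊨⊥ =
  inj₂ (criterion-IN G B Y B⊨⊥) , criterion-IN G B (Y ∨f ¬f X) B⊨⊥

criterion-OUT : ∀ G B Y → LK⊢ [] (Y ∷ []) → Criterion G B Y
criterion-OUT [] _ _ ⊨Y = inj₂ ⊨Y
criterion-OUT ((_ , X) ∷ G) B Y ⊨Y =
  inj₂ (criterion-OUT G B Y ⊨Y) ,
  criterion-OUT G B (Y ∨f ¬f X)
    (LK-succedent-mono [] Y (Y ∨f ¬f X) (Y⊨Y∨Z Y (¬f X)) ⊨Y)

criterion-E1 : ∀ G₁ G₂ A X B Y → LK⊢ (B ∷ []) (A ∷ []) →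
  Criterion (G₁ ++ G₂) B (Y ∨f ¬f X) → Criterion (G₁ ++ (A , X) ∷ G₂) B Y
criterion-E1 [] _ _ _ _ _ B⊨A c = inj₁ B⊨A , c
criterion-E1 ((_ , X′) ∷ G₁) G₂ A X B Y B⊨A (inI , inJ) =
  map₂ (criterion-E1 G₁ G₂ A X B Y B⊨A) inI ,
  criterion-E1 G₁ G₂ A X B (Y ∨f ¬f X′) B⊨A
    (criterion-mono (G₁ ++ G₂) B _ _ (∨-swapʳ-⊨ Y (¬f X) (¬f X′)) inJ)

C₁-weaken : ∀ p {G B Y} → C₁⊢ G (B , Y) → C₁⊢ (p ∷ G) (B , Y)
C₁-weaken p (IN B⊨⊥) = IN B⊨⊥
C₁-weaken p (OUT ⊨Y) = OUT ⊨Y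
C₁-weaken p (E1 {G₁} B⊨A d) = E1 {G₁ = p ∷ G₁} B⊨A (C₁-weaken p d)

C₁⊢⇔Criterion : ∀ G B Y → C₁⊢ G (B , Y) ⇔ Criterion G B Y
C₁⊢⇔Criterion G _ _ = mk⇔ sound (complete G)
  where
  sound : ∀ {G B Y} → C₁⊢ G (B , Y) → Criterion G B Y
  sound {G} {B} {Y} (IN B⊨⊥) = criterion-IN G B Y B⊨⊥
  sound {G} {B} {Y} (OUT ⊨Y) = criterion-OUT G B Y ⊨Y
  sound (E1 {G₁} {G₂} {A} {X} {B} {Y} B⊨A d) = criterion-E1 G₁ G₂ A X B Y B⊨A (sound d)

  complete : ∀ G {B Y} → Criterion G B Y → C₁⊢ G (B , Y)
  complete [] (inj₁ B⊨⊥) = IN B⊨⊥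
  complete [] (inj₂ ⊨Y) = OUT ⊨Y
  complete (_ ∷ G) (inj₁ B⊨A , inJ) = E1 {G₁ = []} B⊨A (complete G inJ)
  complete (p ∷ G) (inj₂ inI , _) = C₁-weaken p (complete G inI)

PartitionClause : ∀ {n} → Vec IOPair n → Formula → Formula → Subset n → Set
PartitionClause ps B Y I =
  (∃[ i ] (i ∈ I × LK⊢ (B ∷ []) (proj₁ (lookup ps i) ∷ [])))
  ⊎ LK⊢ (B ∷ []) []
  ⊎ LK⊢ (outsOutside I ps) (Y ∷ [])

clause-[] : ∀ {B Y} → PartitionClause [] B Y [] ⇔ Criterion [] B Y
clause-[] = mk⇔ (λ { (inj₁ (() , _)) ; (inj₂ c) → c }) inj₂

clause-∈ : ∀ {n A X B Y} {ps : Vec IOPair n} {I} →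
  PartitionClause ((A , X) ∷ ps) B Y (true ∷ I) ⇔
  (LK⊢ (B ∷ []) (A ∷ []) ⊎ PartitionClause ps B Y I)
clause-∈ = mk⇔
  (λ where
    (inj₁ (zero , _ , B⊨A)) → inj₁ B⊨A
    (inj₁ (suc i , there i∈I , B⊨Aᵢ)) → inj₂ (inj₁ (i , i∈I , B⊨Aᵢ))
    (inj₂ c) → inj₂ (inj₂ c))
  (λ where
    (inj₁ B⊨A) → inj₁ (zero , here , B⊨A)
    (inj₂ (inj₁ (i , i∈I , B⊨Aᵢ))) → inj₁ (suc i , there i∈I , B⊨Aᵢ)
    (inj₂ (inj₂ c)) → inj₂ c)

clause-∉ : ∀ {n A X B Y} {ps : Vec IOPair n} {I} →
  PartitionClause ((A , X) ∷ ps) B Y (false ∷ I) ⇔ PartitionClause ps B (Y ∨f ¬f X) I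
clause-∉ {X = X} {Y = Y} {ps} {I} = mk⇔
  (λ where
    (inj₁ (zero , () , _))
    (inj₁ (suc i , there i∈I , B⊨Aᵢ)) → inj₁ (i , i∈I , B⊨Aᵢ)
    (inj₂ c) → inj₂ (map₂ (to (LK-deduction X (outsOutside I ps) Y)) c))
  (λ where
    (inj₁ (i , i∈I , B⊨Aᵢ)) → inj₁ (suc i , there i∈I , B⊨Aᵢ)
    (inj₂ c) → inj₂ (map₂ (from (LK-deduction X (outsOutside I ps) Y)) c))

∀-Subset-⊎ : ∀ {n} {C : Set} {P : Subset n → Set} →
  (∀ I → C ⊎ P I) → C ⊎ (∀ I → P I)
∀-Subset-⊎ {zero} f = map₂ (λ { p [] → p }) (f [])
∀-Subset-⊎ {suc n} f with ∀-Subset-⊎ (λ I → f (true ∷ I)) | ∀-Subset-⊎ (λ I → f (false ∷ I))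
... | inj₁ c | _ = inj₁ c
... | inj₂ _ | inj₁ c = inj₁ c
... | inj₂ pᵗ | inj₂ pᶠ = inj₂ λ { (true ∷ I) → pᵗ I ; (false ∷ I) → pᶠ I }

criterion⇔partitionClauses : ∀ {n} (ps : Vec IOPair n) B Y →
  Criterion (pairsList ps) B Y ⇔ (∀ I → PartitionClause ps B Y I)
criterion⇔partitionClauses ps B Y = mk⇔ (clauses ps Y) (criterion ps Y)
  where
  clauses : ∀ {n} (ps : Vec IOPair n) Y →
    Criterion (pairsList ps) B Y → ∀ I → PartitionClause ps B Y I
  clauses [] Y c [] = from (clause-[] {B} {Y}) c
  clauses (_ ∷ ps) Y (inI , _) (true ∷ I) =
    from (clause-∈ {B = B} {Y}) (map₂ (λ c → clauses ps Y c I) inI)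
  clauses ((_ , X) ∷ ps) Y (_ , inJ) (false ∷ I) =
    from (clause-∉ {B = B} {Y}) (clauses ps (Y ∨f ¬f X) inJ I)

  criterion : ∀ {n} (ps : Vec IOPair n) Y →
    (∀ I → PartitionClause ps B Y I) → Criterion (pairsList ps) B Y
  criterion [] Y f = to (clause-[] {B} {Y}) (f [])
  criterion ((_ , X) ∷ ps) Y f =
    map₂ (criterion ps Y) (∀-Subset-⊎ (λ I → to (clause-∈ {B = B} {Y}) (f (true ∷ I)))) ,
    criterion ps (Y ∨f ¬f X) (λ I → to (clause-∉ {B = B} {Y}) (f (false ∷ I)))

lemma7 : (n : ℕ) (ps : Vec IOPair n) (B Y : Formula) →
    C₁⊢ (pairsList ps) (B , Y) ⇔
    ((I : Subset n) →
      (∃[ i ] (i ∈ I × LK⊢ (B ∷ []) (proj₁ (lookup ps i) ∷ [])))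
      ⊎ LK⊢ (B ∷ []) []
      ⊎ LK⊢ (outsOutside I ps) (Y ∷ []))
lemma7 _ ps B Y =
  ⇔.trans (C₁⊢⇔Criterion (pairsList ps) B Y) (criterion⇔partitionClauses ps B Y)
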